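{- Fix integers $c \geq 0$ and $b \geq 2$. Let $S_{[c,b]}:\mathbb{Z}^+\to\mathbb{Z}^+$ be defined by $S_{[c,b]}\left(\sum_{i=0}^n a_i b^i\right) = c + \sum_{i=0}^n a_i^2$ (base $b$ expansion, $0\le a_i\le b-1$, $a_n\ne0$), and let $\mathcal{F}^{(1)}_{[c,b]} = \{a = ub \mid 0 < u < b \text{ and } S_{[c,b]}(a) = a\}$. Then \[ \left|\mathcal{F}^{(1)}_{[c,b]}\right| = \begin{cases} 2 & \text{if } \alpha^2 - \alpha b + c = 0 \text{ for some integer } 1 \le \alpha < \tfrac{1}{2} b,\\ 1 & \text{if } b^2 = 4c,\\ 0 & \text{otherwise.}\end{cases} \] -}

module Defs where

open import Data.Nat using (ℕ; _+_; _*_; _≤_; _<_; _≤?_)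
open import Data.Nat.ListAction using (sum)
open import Data.List using (map)
open import Data.Fin using (Fin; toℕ)
open import Data.Product using (Σ; ∃; _×_; proj₁)
open import Data.Digit using (toDigits)
open import Relation.Nullary.Decidable using (fromWitness)
open import Relation.Binary.PropositionalEquality using (_≡_)
open import Function.Bundles using (_↔_)

-- S_[c,b](n) = c + sum of squares of the base-b digits of n.
-- (toDigits gives the base-b expansion; leading zero digits, if any,
--  contribute 0 to the sum, so this matches the paper's definition.)
S : (c b : ℕ) → 2 ≤ b → ℕ → ℕ
S c b 2≤b n = c + sum (map (λ d → toℕ d * toℕ d) (proj₁ (toDigits b {fromWitness 2≤b} n)))

F1 : (c b : ℕ) → 2 ≤ b → ℕ → Set
F1 c b 2≤b a = ∃ λ u → 0 < u × u < b × a ≡ u * b × S c b 2≤b a ≡ a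

HasCard : ∀ {a} → (X : Set a) → ℕ → Set a
HasCard X k = Fin k ↔ X

{-# OPTIONS --safe #-}
-- For a = u b with 0 < u < b the base-b digits of a are 0 and u, so S(a) = c + u² and a is a
-- fixed point iff u is a root of x² − b x + c. Roots come in pairs u, b − u (then c = u (b − u)),
-- and two distinct roots always sum to b. So there are two fixed points when some root lies
-- below b/2, exactly one when b/2 is a double root (b² = 4c, which forces b to be even), and
-- none otherwise.
module Submission where

open import Defs
open import Data.Nat using (ℕ; _+_; _*_; _∸_; _≤_; _<_; _%_; zero; suc; z≤n; s≤s; NonZero; >-nonZero; >-nonZero⁻¹)
open import Data.Nat.Properties
open import Data.Nat.DivMod using ([m+kn]%n≡m%n; m<n⇒m%n≡m)
open import Data.Nat.Divisibility using (_∣_; divides; quotient)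
open _∣_ using (equality)
open import Data.Nat.Primality using (prime?; euclidsLemma)
open import Data.Nat.ListAction using (sum)
open import Data.Nat.Tactic.RingSolver using (solve-∀)
open import Data.List using ([]; _∷_; map)
open import Data.Fin using (Fin; toℕ) renaming (zero to fzero; suc to fsuc)
open import Data.Fin.Properties using (toℕ<n)
open import Data.Digit using (toDigits; fromDigits; Expansion)
open import Data.Product using (Σ; ∃; _×_; _,_; proj₁; proj₂)
open import Data.Sum using (_⊎_; inj₁; inj₂; [_,_]′)
import Data.Sum as Sum
open import Relation.Nullary using (¬_; contradiction)
open import Relation.Nullary.Decidable using (from-yes; fromWitness)
open import Relation.Binary using (tri<; tri≈; tri>)
open import Relation.Binary.PropositionalEquality
open import Function using (id)
open import Function.Bundles using (_⇔_; mk⇔; mk↔ₛ′; Equivalence)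

open ≡-Reasoning

r+q*n-injective : ∀ {n r r′ q q′} .{{_ : NonZero n}} → r < n → r′ < n →
                  r + q * n ≡ r′ + q′ * n → r ≡ r′ × q ≡ q′
r+q*n-injective {n} {r} {r′} {q} {q′} r<n r′<n eq =
  r≡r′ , *-cancelʳ-≡ q q′ n (+-cancelˡ-≡ r _ _ (trans eq (cong (_+ q′ * n) (sym r≡r′))))
  where
  r≡r′ : r ≡ r′
  r≡r′ = begin
    r                 ≡⟨ m<n⇒m%n≡m r<n ⟨
    r % n             ≡⟨ [m+kn]%n≡m%n r q n ⟨
    (r + q * n) % n   ≡⟨ cong (_% n) eq ⟩
    (r′ + q′ * n) % n ≡⟨ [m+kn]%n≡m%n r′ q′ n ⟩
    r′ % n            ≡⟨ m<n⇒m%n≡m r′<n ⟩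
    r′                ∎

digitSquareSum : ∀ {b} → Expansion b → ℕ
digitSquareSum ds = sum (map (λ d → toℕ d * toℕ d) ds)

module _ {b} .{{_ : NonZero b}} where

  digitSquareSum-digit : ∀ {u} (ds : Expansion b) → u < b → fromDigits ds ≡ u →
                         digitSquareSum ds ≡ u * u
  digitSquareSum-digit [] _ refl = refl
  digitSquareSum-digit {u} (d ∷ ds) u<b eq
    with d≡u , rest≡0 ← r+q*n-injective (toℕ<n d) u<b (trans eq (sym (+-identityʳ u))) =
    trans (cong₂ _+_ (cong (λ x → x * x) d≡u) (digitSquareSum-digit ds (>-nonZero⁻¹ b) rest≡0))
          (+-identityʳ (u * u))

  digitSquareSum-digit*base : ∀ {u} (ds : Expansion b) → u < b → fromDigits ds ≡ u * b →
                              digitSquareSum ds ≡ u * u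
  digitSquareSum-digit*base {u} [] _ eq with refl ← m*n≡0⇒m≡0 u b (sym eq) = refl
  digitSquareSum-digit*base (d ∷ ds) u<b eq
    with d≡0 , rest≡u ← r+q*n-injective (toℕ<n d) (>-nonZero⁻¹ b) eq =
    cong₂ _+_ (cong (λ x → x * x) d≡0) (digitSquareSum-digit ds u<b rest≡u)

module _ {a ℓ} {A : Set a} {P : A → Set ℓ} (P-irrelevant : ∀ {x} (p q : P x) → p ≡ q) where

  Σ-≡ : {x y : Σ A P} → proj₁ x ≡ proj₁ y → x ≡ y
  Σ-≡ {x , p} {.x , q} refl = cong (x ,_) (P-irrelevant p q)

  Σ-card-0 : (∀ {x} → ¬ P x) → HasCard (Σ A P) 0
  Σ-card-0 ¬P = mk↔ₛ′ (λ ()) (λ (_ , p) → contradiction p ¬P) (λ (_ , p) → contradiction p ¬P) (λ ())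

  Σ-card-1 : ∀ {x} → P x → (∀ {z} → P z → z ≡ x) → HasCard (Σ A P) 1
  Σ-card-1 {x} px unique =
    mk↔ₛ′ (λ _ → x , px) (λ _ → fzero) (λ (_ , pz) → Σ-≡ (sym (unique pz))) λ { fzero → refl; (fsuc ()) }

  Σ-card-2 : ∀ {x y} → P x → P y → x ≢ y → (∀ {z} → P z → z ≡ x ⊎ z ≡ y) →
             HasCard (Σ A P) 2
  Σ-card-2 {x} {y} px py x≢y classify = mk↔ₛ′ to from to∘from from∘to
    where
    to : Fin 2 → Σ A P
    to fzero        = x , px
    to (fsuc fzero) = y , py
    from : Σ A P → Fin 2
    from (_ , pz) = [ (λ _ → fzero) , (λ _ → fsuc fzero) ]′ (classify pz)
    to∘from : ∀ z → to (from z) ≡ z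
    to∘from (_ , pz) with classify pz
    ... | inj₁ z≡x = Σ-≡ (sym z≡x)
    ... | inj₂ z≡y = Σ-≡ (sym z≡y)
    from∘to : ∀ i → from (to i) ≡ i
    from∘to fzero with classify px
    ... | inj₁ _   = refl
    ... | inj₂ x≡y = contradiction x≡y x≢y
    from∘to (fsuc fzero) with classify py
    ... | inj₁ y≡x = contradiction (sym y≡x) x≢y
    ... | inj₂ _   = refl

IsRoot : (c b u : ℕ) → Set
IsRoot c b u = u * u + c ≡ u * b

SmallRoot : (c b : ℕ) → Set
SmallRoot c b = ∃ λ α → 1 ≤ α × 2 * α < b × IsRoot c b α

module _ {c b : ℕ} (u v : ℕ) (u+v≡b : u + v ≡ b) where

  IsRoot⇒c≡u*v : IsRoot c b u → c ≡ u * v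
  IsRoot⇒c≡u*v root = +-cancelˡ-≡ (u * u) c (u * v) (begin
    u * u + c       ≡⟨ root ⟩
    u * b           ≡⟨ cong (u *_) u+v≡b ⟨
    u * (u + v)     ≡⟨ *-distribˡ-+ u u v ⟩
    u * u + u * v   ∎)

  c≡u*v⇒IsRoot : c ≡ u * v → IsRoot c b u
  c≡u*v⇒IsRoot c≡u*v = begin
    u * u + c       ≡⟨ cong (u * u +_) c≡u*v ⟩
    u * u + u * v   ≡⟨ *-distribˡ-+ u u v ⟨
    u * (u + v)     ≡⟨ cong (u *_) u+v≡b ⟩
    u * b           ∎

IsRoot-complement : ∀ {c b} u v → u + v ≡ b → IsRoot c b u → IsRoot c b v
IsRoot-complement u v u+v≡b root =
  c≡u*v⇒IsRoot v u (trans (+-comm v u) u+v≡b) (trans (IsRoot⇒c≡u*v u v u+v≡b root) (*-comm u v))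

2*u<b⇔u<v : ∀ {b} u v → u + v ≡ b → 2 * u < b ⇔ u < v
2*u<b⇔u<v u v u+v≡b = mk⇔
  (λ 2u<b → +-cancelˡ-< u u v (subst₂ _<_ 2*u≡u+u (sym u+v≡b) 2u<b))
  (λ u<v → subst₂ _<_ (sym 2*u≡u+u) u+v≡b (+-monoʳ-< u u<v))
  where
  2*u≡u+u : 2 * u ≡ u + u
  2*u≡u+u = cong (u +_) (+-identityʳ u)

IsRoot-difference : ∀ {c b} u d → IsRoot c b u → IsRoot c b (u + d) → d * (u + (u + d)) ≡ d * b
IsRoot-difference {c} {b} u d root-u root-w = +-cancelˡ-≡ (u * b) _ _ (begin
  u * b + d * (u + (u + d))       ≡⟨ cong (_+ d * (u + (u + d))) root-u ⟨
  u * u + c + d * (u + (u + d))   ≡⟨ expand u d c ⟩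
  (u + d) * (u + d) + c           ≡⟨ root-w ⟩
  (u + d) * b                     ≡⟨ *-distribʳ-+ b u d ⟩
  u * b + d * b                   ∎)
  where
  expand : ∀ u d c → u * u + c + d * (u + (u + d)) ≡ (u + d) * (u + d) + c
  expand = solve-∀

IsRoot-pair-≤ : ∀ {c b} u w → IsRoot c b u → IsRoot c b w → u ≤ w → u ≡ w ⊎ u + w ≡ b
IsRoot-pair-≤ u w root-u root-w u≤w with m≤n⇒∃[o]m+o≡n u≤w
... | zero  , refl = inj₁ (sym (+-identityʳ u))
... | suc d , refl = inj₂ (*-cancelˡ-≡ _ _ (suc d) (IsRoot-difference u (suc d) root-u root-w))

IsRoot-pair : ∀ {c b} u w → IsRoot c b u → IsRoot c b w → u ≡ w ⊎ u + w ≡ b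
IsRoot-pair u w root-u root-w with ≤-total u w
... | inj₁ u≤w = IsRoot-pair-≤ u w root-u root-w u≤w
... | inj₂ w≤u = Sum.map sym (trans (+-comm u w)) (IsRoot-pair-≤ w u root-w root-u w≤u)

IsRoot⇒SmallRoot⊎b*b≡4*c : ∀ {c b} u v → 0 < u → 0 < v → u + v ≡ b → IsRoot c b u →
                           SmallRoot c b ⊎ b * b ≡ 4 * c
IsRoot⇒SmallRoot⊎b*b≡4*c {c} {b} u v 0<u 0<v u+v≡b root-u with <-cmp u v
... | tri< u<v _ _ = inj₁ (u , 0<u , Equivalence.from (2*u<b⇔u<v u v u+v≡b) u<v , root-u)
... | tri> _ _ v<u = inj₁ (v , 0<v , Equivalence.from (2*u<b⇔u<v v u v+u≡b) v<u , root-v)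
  where
  v+u≡b = trans (+-comm v u) u+v≡b
  root-v = IsRoot-complement u v u+v≡b root-u
... | tri≈ _ refl _ = inj₂ (begin
    b * b             ≡⟨ cong (λ x → x * x) u+v≡b ⟨
    (u + u) * (u + u) ≡⟨ square-double u ⟩
    4 * (u * u)       ≡⟨ cong (4 *_) (IsRoot⇒c≡u*v u u u+v≡b root-u) ⟨
    4 * c             ∎)
  where
  square-double : ∀ u → (u + u) * (u + u) ≡ 4 * (u * u)
  square-double = solve-∀

b*b≡4*c⇒b≡k+k : ∀ {b c} → b * b ≡ 4 * c → ∃ λ k → b ≡ k + k × c ≡ k * k
b*b≡4*c⇒b≡k+k {b} {c} bb≡4c = k , b≡k+k , *-cancelˡ-≡ c (k * k) 4 (begin
    4 * c             ≡⟨ bb≡4c ⟨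
    b * b             ≡⟨ cong (λ x → x * x) b≡k+k ⟩
    (k + k) * (k + k) ≡⟨ square-double k ⟩
    4 * (k * k)       ∎)
  where
  2∣b : 2 ∣ b
  2∣b = [ id , id ]′ (euclidsLemma b b (from-yes (prime? 2)) 2∣b*b)
    where
    4c≡2c*2 : ∀ c → 4 * c ≡ 2 * c * 2
    4c≡2c*2 = solve-∀
    2∣b*b : 2 ∣ b * b
    2∣b*b = divides (2 * c) (trans bb≡4c (4c≡2c*2 c))
  k = quotient 2∣b
  b≡k+k : b ≡ k + k
  b≡k+k = trans (equality 2∣b) (k*2≡k+k k)
    where
    k*2≡k+k : ∀ k → k * 2 ≡ k + k
    k*2≡k+k = solve-∀
  square-double : ∀ k → (k + k) * (k + k) ≡ 4 * (k * k)
  square-double = solve-∀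

module _ (c b : ℕ) (2≤b : 2 ≤ b) where

  private instance
    b-nonZero : NonZero b
    b-nonZero = >-nonZero (≤-trans (s≤s z≤n) 2≤b)

  S-digit*base : ∀ {u} → u < b → S c b 2≤b (u * b) ≡ c + u * u
  S-digit*base {u} u<b = cong (c +_) (digitSquareSum-digit*base (proj₁ digits) u<b (proj₂ digits))
    where digits = toDigits b {fromWitness 2≤b} (u * b)

  F1-intro : ∀ {u} → 0 < u → u < b → IsRoot c b u → F1 c b 2≤b (u * b)
  F1-intro {u} 0<u u<b root = u , 0<u , u<b , refl , (begin
    S c b 2≤b (u * b) ≡⟨ S-digit*base u<b ⟩
    c + u * u         ≡⟨ +-comm c (u * u) ⟩
    u * u + c         ≡⟨ root ⟩
    u * b             ∎)

  F1⇒IsRoot : ∀ {a} (f : F1 c b 2≤b a) → IsRoot c b (proj₁ f)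
  F1⇒IsRoot (u , _ , u<b , refl , fixed) = begin
    u * u + c         ≡⟨ +-comm (u * u) c ⟩
    c + u * u         ≡⟨ S-digit*base u<b ⟨
    S c b 2≤b (u * b) ≡⟨ fixed ⟩
    u * b             ∎

  F1-irrelevant : ∀ {a} (f g : F1 c b 2≤b a) → f ≡ g
  F1-irrelevant (u , 0<u , u<b , a≡ub , s) (v , 0<v , v<b , a≡vb , t)
    with refl ← *-cancelʳ-≡ u v b (trans (sym a≡ub) a≡vb) =
    cong₂ (λ p q → u , p , q) (<-irrelevant 0<u 0<v)
      (cong₂ _,_ (<-irrelevant u<b v<b) (cong₂ _,_ (≡-irrelevant a≡ub a≡vb) (≡-irrelevant s t)))

  two-fixed-points : SmallRoot c b → HasCard (Σ ℕ (F1 c b 2≤b)) 2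
  two-fixed-points (α , 1≤α , 2α<b , root-α) =
    Σ-card-2 F1-irrelevant (F1-intro 1≤α α<b root-α) (F1-intro 0<β β<b root-β) αb≢βb classify
    where
    β = b ∸ α
    α+β≡b : α + β ≡ b
    α+β≡b = m+[n∸m]≡n (≤-trans (m≤m+n α _) (<⇒≤ 2α<b))
    α<β : α < β
    α<β = Equivalence.to (2*u<b⇔u<v α β α+β≡b) 2α<b
    0<β : 0 < β
    0<β = ≤-trans (s≤s z≤n) α<β
    α<b : α < b
    α<b = subst (α <_) α+β≡b (m<m+n α 0<β)
    β<b : β < b
    β<b = subst (β <_) α+β≡b (m<n+m β 1≤α)
    root-β : IsRoot c b β
    root-β = IsRoot-complement α β α+β≡b root-α
    αb≢βb : α * b ≢ β * b
    αb≢βb eq = <⇒≢ α<β (*-cancelʳ-≡ α β b eq)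
    classify : ∀ {a} → F1 c b 2≤b a → a ≡ α * b ⊎ a ≡ β * b
    classify f@(u , _ , _ , refl , _) with IsRoot-pair u α (F1⇒IsRoot f) root-α
    ... | inj₁ u≡α   = inj₁ (cong (_* b) u≡α)
    ... | inj₂ u+α≡b = inj₂ (cong (_* b) (+-cancelʳ-≡ α u β (trans u+α≡b (sym β+α≡b))))
      where β+α≡b = trans (+-comm β α) α+β≡b

  one-fixed-point-of-double-root : (∃ λ k → b ≡ k + k × c ≡ k * k) → HasCard (Σ ℕ (F1 c b 2≤b)) 1
  one-fixed-point-of-double-root (k , b≡k+k , c≡k*k) =
    Σ-card-1 F1-irrelevant (F1-intro 0<k k<b root-k) classify
    where
    0<k : 0 < k
    0<k = n≢0⇒n>0 λ { refl → contradiction (subst (2 ≤_) b≡k+k 2≤b) λ () }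
    k<b : k < b
    k<b = subst (k <_) (sym b≡k+k) (m<m+n k 0<k)
    root-k : IsRoot c b k
    root-k = c≡u*v⇒IsRoot k k (sym b≡k+k) c≡k*k
    classify : ∀ {a} → F1 c b 2≤b a → a ≡ k * b
    classify f@(u , _ , _ , refl , _) with IsRoot-pair u k (F1⇒IsRoot f) root-k
    ... | inj₁ u≡k   = cong (_* b) u≡k
    ... | inj₂ u+k≡b = cong (_* b) (+-cancelʳ-≡ k u k (trans u+k≡b b≡k+k))

  one-fixed-point : b * b ≡ 4 * c → HasCard (Σ ℕ (F1 c b 2≤b)) 1
  one-fixed-point bb≡4c = one-fixed-point-of-double-root (b*b≡4*c⇒b≡k+k bb≡4c)

  no-fixed-point : ¬ SmallRoot c b → ¬ (b * b ≡ 4 * c) → HasCard (Σ ℕ (F1 c b 2≤b)) 0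
  no-fixed-point ¬small ¬double = Σ-card-0 F1-irrelevant λ f@(u , 0<u , u<b , _) →
    [ ¬small , ¬double ]′ (IsRoot⇒SmallRoot⊎b*b≡4*c u (b ∸ u) 0<u (m<n⇒0<n∸m u<b)
                                                    (m+[n∸m]≡n (<⇒≤ u<b)) (F1⇒IsRoot f))

lemma3p2 : (c b : ℕ) (2≤b : 2 ≤ b) →
    ((∃ λ α → 1 ≤ α × 2 * α < b × α * α + c ≡ α * b) → HasCard (Σ ℕ (F1 c b 2≤b)) 2) ×
    (b * b ≡ 4 * c → HasCard (Σ ℕ (F1 c b 2≤b)) 1) ×
    (¬ (∃ λ α → 1 ≤ α × 2 * α < b × α * α + c ≡ α * b) → ¬ (b * b ≡ 4 * c) → HasCard (Σ ℕ (F1 c b 2≤b)) 0)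
lemma3p2 c b 2≤b = two-fixed-points c b 2≤b , one-fixed-point c b 2≤b , no-fixed-point c b 2≤b
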